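{- For all integers $d\geq 1$ we have $A_{\mathbf{r}}(2d)=A_{\mathbf{r}}(d)$.
   Context: For $n\in\mathbb{N}$, $e_{11}(n)$ is the number of (possibly overlapping) occurrences of $11$ in the binary expansion of $n$, and $r_n=e_{11}(n)\bmod 2$. For $n,d\in\mathbb{N}$, $d\geq1$: $A_{\mathbf{r}}(n,d)=\inf\{l\geq 1: r_{n+ld}\neq r_n\}$ and $A_{\mathbf{r}}(d)=\sup_{n\in\mathbb{N}}A_{\mathbf{r}}(n,d)$. -}

module Defs where

open import Data.Nat using (ℕ; zero; suc; _+_; _*_; _≤_)
open import Data.Nat.DivMod using (_%_; _/_)
open import Data.Bool using (Bool; true; false)
open import Data.List using (List; []; _∷_)
open import Data.Product using (∃; _×_)
open import Relation.Binary.PropositionalEquality using (_≢_)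

-- Binary digits of n, least significant first, computed with fuel.
-- Fuel f ≥ (number of binary digits of n) suffices; fuel n is always enough
-- since n / 2 < n for n ≥ 1.
bitsF : ℕ → ℕ → List Bool
bitsF zero    n = []
bitsF (suc f) zero = []
bitsF (suc f) (suc m) with (suc m) % 2
... | zero  = false ∷ bitsF f (suc m / 2)
... | suc _ = true  ∷ bitsF f (suc m / 2)

-- binary expansion of n (no leading zeros; empty for n = 0)
bits : ℕ → List Bool
bits n = bitsF n n

count11 : List Bool → ℕ
count11 (true ∷ true ∷ xs) = suc (count11 (true ∷ xs))
count11 (_ ∷ xs)           = count11 xs
count11 []                 = 0

e11 : ℕ → ℕ
e11 n = count11 (bits n)

r : ℕ → ℕ
r n = e11 n % 2

Change : ℕ → ℕ → ℕ → Set
Change n d l = 1 ≤ l × r (n + l * d) ≢ r n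

-- A_r(n,d) ≤ L  (A_r(n,d) = inf of that set, with inf ∅ = ∞)
A-pt≤ : ℕ → ℕ → ℕ → Set
A-pt≤ n d L = ∃ λ l → Change n d l × l ≤ L

-- A_r(d) ≤ L  (A_r(d) = sup over n of A_r(n,d), in ℕ ∪ {∞})
A≤ : ℕ → ℕ → Set
A≤ d L = ∀ n → A-pt≤ n d L

{-# OPTIONS --safe #-}
-- Write ρ n ∈ ℤ/2 for the parity of e₁₁(n). Appending a binary digit gives ρ(2n) = ρ(n) and
-- ρ(2n+1) = ρ(n) + (n mod 2). Hence r changes along 2n, 2n + 2d, … exactly where it changes
-- along n, n + d, …, which settles even starting points in both directions. From an odd start
-- 2m+1 the question is when ρ(2(m + l d) + 1) first differs from ρ(2m+1). The (J+1)-digit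
-- complement c = 2^{J+1} − 1 − k of any k < 2^J satisfies ρ(c) + ρ(2k+1) = J mod 2, so applying
-- the hypothesis at the complement N of X = m + L d, where stepping forward l ≤ L times from N
-- mirrors stepping back from X to m + (L − l) d, yields some i ≤ L with ρ(2(m+id)+1) ≠ ρ(2X+1);
-- then i or L is a change point for 2m+1.
module Submission where

open import Defs
open import Data.Nat using (ℕ; _*_; _≤_)
open import Function.Bundles using (_⇔_; mk⇔; Equivalence)
open import Data.Nat using (zero; suc; _+_; _∸_; _^_; _<_; z≤n; s≤s; parity)
open import Data.Nat.Properties
open import Data.Nat.DivMod using (_%_; _/_; m*n/n≡m; m/n<m; +-distrib-/-∣ʳ)
open import Data.Nat.Divisibility using (m∣m*n)
open import Data.Nat.Tactic.RingSolver using (solve-∀)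
open import Data.Parity.Base as ℙ using (Parity; 0ℙ; 1ℙ; _⁻¹)
open import Data.Parity.Properties as ℙ using (+-homo-+; *-homo-*; suc-homo-⁻¹)
open import Algebra.Properties.CommutativeSemigroup ℙ.+-commutativeSemigroup using (x∙yz≈y∙xz)
open import Data.Bool using (Bool; true; false)
open import Data.List using (_∷_)
open import Data.Product using (∃; _×_; _,_)
open import Data.Empty using (⊥-elim)
open import Function using (_∘_; flip)
open import Relation.Nullary using (yes; no)
open import Relation.Binary.PropositionalEquality

bit : ℕ → Bool
bit zero    = false
bit (suc _) = true

bitsF-suc : ∀ f m → bitsF (suc f) (suc m) ≡ bit (suc m % 2) ∷ bitsF f (suc m / 2)
bitsF-suc f m with suc m % 2
... | zero  = refl
... | suc _ = refl

suc-/2-≤ : ∀ m → suc m / 2 ≤ m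
suc-/2-≤ m = ≤-pred (m/n<m (suc m) 2 (s≤s (s≤s z≤n)))

bitsF-fuel-irrelevant : ∀ {f g} n → n ≤ f → n ≤ g → bitsF f n ≡ bitsF g n
bitsF-fuel-irrelevant {zero}  {zero}  zero _ _ = refl
bitsF-fuel-irrelevant {zero}  {suc _} zero _ _ = refl
bitsF-fuel-irrelevant {suc _} {zero}  zero _ _ = refl
bitsF-fuel-irrelevant {suc _} {suc _} zero _ _ = refl
bitsF-fuel-irrelevant {suc f} {suc g} (suc m) (s≤s m≤f) (s≤s m≤g) = begin
  bitsF (suc f) (suc m)                 ≡⟨ bitsF-suc f m ⟩
  bit (suc m % 2) ∷ bitsF f (suc m / 2) ≡⟨ cong (bit (suc m % 2) ∷_) tail-≡ ⟩
  bit (suc m % 2) ∷ bitsF g (suc m / 2) ≡⟨ bitsF-suc g m ⟨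
  bitsF (suc g) (suc m)                 ∎
  where
  open ≡-Reasoning
  tail-≡ : bitsF f (suc m / 2) ≡ bitsF g (suc m / 2)
  tail-≡ = bitsF-fuel-irrelevant (suc m / 2) (≤-trans (suc-/2-≤ m) m≤f) (≤-trans (suc-/2-≤ m) m≤g)

bits-suc : ∀ m → bits (suc m) ≡ bit (suc m % 2) ∷ bits (suc m / 2)
bits-suc m = trans (bitsF-suc m m)
  (cong (bit (suc m % 2) ∷_) (bitsF-fuel-irrelevant (suc m / 2) (suc-/2-≤ m) ≤-refl))

toℕ : Parity → ℕ
toℕ 0ℙ = 0
toℕ 1ℙ = 1

toℕ-injective : ∀ {p q} → toℕ p ≡ toℕ q → p ≡ q
toℕ-injective {0ℙ} {0ℙ} _ = refl
toℕ-injective {1ℙ} {1ℙ} _ = refl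

%2≡toℕ∘parity : ∀ n → n % 2 ≡ toℕ (parity n)
%2≡toℕ∘parity zero          = refl
%2≡toℕ∘parity (suc zero)    = refl
%2≡toℕ∘parity (suc (suc n)) = %2≡toℕ∘parity n

parity-double : ∀ n → parity (2 * n) ≡ 0ℙ
parity-double n = *-homo-* 2 n

parity-suc : ∀ n → parity (suc n) ≡ 1ℙ ℙ.+ parity n
parity-suc n = +-homo-+ 1 n

parity-double+1 : ∀ n → parity (suc (2 * n)) ≡ 1ℙ
parity-double+1 n = trans (parity-suc (2 * n)) (cong _⁻¹ (parity-double n))

double-/2 : ∀ n → 2 * n / 2 ≡ n
double-/2 n = trans (cong (_/ 2) (*-comm 2 n)) (m*n/n≡m n 2)

double+1-/2 : ∀ n → suc (2 * n) / 2 ≡ n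
double+1-/2 n = trans (+-distrib-/-∣ʳ 1 {d = 2} (m∣m*n n)) (double-/2 n)

bits-double : ∀ n → bits (2 * suc n) ≡ false ∷ bits (suc n)
bits-double n = trans (bits-suc _) (cong₂ _∷_
  (cong bit (trans (%2≡toℕ∘parity (2 * suc n)) (cong toℕ (parity-double (suc n)))))
  (cong bits (double-/2 (suc n))))

bits-double+1 : ∀ n → bits (suc (2 * n)) ≡ true ∷ bits n
bits-double+1 n = trans (bits-suc _) (cong₂ _∷_
  (cong bit (trans (%2≡toℕ∘parity (suc (2 * n))) (cong toℕ (parity-double+1 n))))
  (cong bits (double+1-/2 n)))

-- r with values in the group ℤ/2, where its recurrences become additive
ρ : ℕ → Parity
ρ n = parity (e11 n)

r≡toℕ∘ρ : ∀ n → r n ≡ toℕ (ρ n)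
r≡toℕ∘ρ n = %2≡toℕ∘parity (e11 n)

r-≡⇒ρ-≡ : ∀ m n → r m ≡ r n → ρ m ≡ ρ n
r-≡⇒ρ-≡ m n eq = toℕ-injective (trans (sym (r≡toℕ∘ρ m)) (trans eq (r≡toℕ∘ρ n)))

e11-double : ∀ n → e11 (2 * n) ≡ e11 n
e11-double zero    = refl
e11-double (suc n) = cong count11 (bits-double n)

e11-double+1-even : ∀ n → e11 (suc (2 * (2 * n))) ≡ e11 n
e11-double+1-even zero    = refl
e11-double+1-even (suc n) = begin
  count11 (bits (suc (2 * (2 * suc n)))) ≡⟨ cong count11 (bits-double+1 (2 * suc n)) ⟩
  count11 (true ∷ bits (2 * suc n))      ≡⟨ cong (count11 ∘ (true ∷_)) (bits-double n) ⟩
  e11 (suc n)                            ∎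
  where open ≡-Reasoning

e11-double+1-odd : ∀ n → e11 (suc (2 * suc (2 * n))) ≡ suc (e11 (suc (2 * n)))
e11-double+1-odd n = begin
  count11 (bits (suc (2 * suc (2 * n)))) ≡⟨ cong count11 (bits-double+1 (suc (2 * n))) ⟩
  count11 (true ∷ bits (suc (2 * n)))    ≡⟨ cong (count11 ∘ (true ∷_)) (bits-double+1 n) ⟩
  suc (count11 (true ∷ bits n))          ≡⟨ cong (suc ∘ count11) (bits-double+1 n) ⟨
  suc (e11 (suc (2 * n)))                ∎
  where open ≡-Reasoning

r-double : ∀ n → r (2 * n) ≡ r n
r-double n = cong (_% 2) (e11-double n)

ρ-double : ∀ n → ρ (2 * n) ≡ ρ n
ρ-double n = cong parity (e11-double n)

ρ-double+1-even : ∀ n → ρ (suc (2 * (2 * n))) ≡ ρ n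
ρ-double+1-even n = cong parity (e11-double+1-even n)

ρ-double+1-odd : ∀ n → ρ (suc (2 * suc (2 * n))) ≡ 1ℙ ℙ.+ ρ (suc (2 * n))
ρ-double+1-odd n = trans (cong parity (e11-double+1-odd n)) (parity-suc (e11 (suc (2 * n))))

data Halving : ℕ → Set where
  even : ∀ k → Halving (2 * k)
  odd  : ∀ k → Halving (suc (2 * k))

halving : ∀ n → Halving n
halving zero = even zero
halving (suc n) with halving n
... | even k = odd k
... | odd k  = subst Halving (*-suc 2 k) (even (suc k))

ρ-double+1 : ∀ n → ρ (suc (2 * n)) ≡ ρ n ℙ.+ parity n
ρ-double+1 n with halving n
... | even k = begin
  ρ (suc (2 * (2 * k)))      ≡⟨ ρ-double+1-even k ⟩
  ρ k                        ≡⟨ ℙ.+-identityʳ (ρ k) ⟨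
  ρ k ℙ.+ 0ℙ                 ≡⟨ cong₂ ℙ._+_ (ρ-double k) (parity-double k) ⟨
  ρ (2 * k) ℙ.+ parity (2 * k) ∎
  where open ≡-Reasoning
... | odd k = begin
  ρ (suc (2 * suc (2 * k)))              ≡⟨ ρ-double+1-odd k ⟩
  1ℙ ℙ.+ ρ (suc (2 * k))                 ≡⟨ ℙ.+-comm 1ℙ _ ⟩
  ρ (suc (2 * k)) ℙ.+ 1ℙ                 ≡⟨ cong (ρ (suc (2 * k)) ℙ.+_) (parity-double+1 k) ⟨
  ρ (suc (2 * k)) ℙ.+ parity (suc (2 * k)) ∎
  where open ≡-Reasoning

data HalvedSum (w : ℕ) : ℕ → ℕ → Set where
  even+odd : ∀ k c → suc (k + c) ≡ w → HalvedSum w (2 * k) (suc (2 * c))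
  odd+even : ∀ k c → suc (k + c) ≡ w → HalvedSum w (suc (2 * k)) (2 * c)

halvedSum : ∀ {w} k c → suc (k + c) ≡ 2 * w → HalvedSum w k c
halvedSum {w} k c eq with halving k | halving c
... | even k | even c = ⊥-elim (even≢odd w (k + c) (trans (sym eq) (cong suc (sym (*-distribˡ-+ 2 k c)))))
... | odd k  | odd c  = ⊥-elim (even≢odd w (suc (k + c)) (trans (sym eq) (cong suc (odd+odd k c))))
  where
  odd+odd : ∀ k c → suc (2 * k) + suc (2 * c) ≡ 2 * suc (k + c)
  odd+odd = solve-∀
... | even k | odd c  = even+odd k c (*-cancelˡ-≡ _ _ 2 (trans (even+odd≡ k c) eq))
  where
  even+odd≡ : ∀ k c → 2 * suc (k + c) ≡ suc (2 * k + suc (2 * c))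
  even+odd≡ = solve-∀
... | odd k  | even c = odd+even k c (*-cancelˡ-≡ _ _ 2 (trans (odd+even≡ k c) eq))
  where
  odd+even≡ : ∀ k c → 2 * suc (k + c) ≡ suc (suc (2 * k) + 2 * c)
  odd+even≡ = solve-∀

parity-complement : ∀ {w} m n → suc (m + n) ≡ 2 * w → parity n ≡ 1ℙ ℙ.+ parity m
parity-complement {w} m n eq = begin
  parity n                                   ≡⟨ cong (ℙ._+ parity n) (ℙ.p+p≡0ℙ (parity m)) ⟨
  (parity m ℙ.+ parity m) ℙ.+ parity n       ≡⟨ ℙ.+-assoc (parity m) (parity m) (parity n) ⟩
  parity m ℙ.+ (parity m ℙ.+ parity n)       ≡⟨ cong (parity m ℙ.+_) (trans (sym (+-homo-+ m n)) sum-odd) ⟩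
  parity m ℙ.+ 1ℙ                            ≡⟨ ℙ.+-comm (parity m) 1ℙ ⟩
  1ℙ ℙ.+ parity m                            ∎
  where
  open ≡-Reasoning
  sum-odd : parity (m + n) ≡ 1ℙ
  sum-odd = trans (sym (suc-homo-⁻¹ (m + n))) (cong _⁻¹ (trans (cong parity eq) (parity-double w)))

-- The binary digits of c are a 1 followed by the complements of the J digits of k.
ρ-complement : ∀ J k c → k < 2 ^ J → suc (k + c) ≡ 2 ^ suc J →
               ρ c ℙ.+ ρ (suc (2 * k)) ≡ parity J
ρ-complement zero    zero    .1 _        refl = refl
ρ-complement zero    (suc k) c  (s≤s ()) _
ρ-complement (suc J) k       c  k<2^J+1  eq with halvedSum {2 ^ suc J} k c eq
... | even+odd k c eq′ = begin
  ρ (suc (2 * c)) ℙ.+ ρ (suc (2 * (2 * k))) ≡⟨ cong₂ ℙ._+_ (ρ-double+1 c) (ρ-double+1-even k) ⟩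
  (ρ c ℙ.+ parity c) ℙ.+ ρ k                ≡⟨ cong (λ p → (ρ c ℙ.+ p) ℙ.+ ρ k) c-parity ⟩
  (ρ c ℙ.+ (1ℙ ℙ.+ parity k)) ℙ.+ ρ k       ≡⟨ regroup (ρ c) 1ℙ (parity k) (ρ k) ⟩
  1ℙ ℙ.+ (ρ c ℙ.+ (ρ k ℙ.+ parity k))       ≡⟨ cong (λ p → 1ℙ ℙ.+ (ρ c ℙ.+ p)) (ρ-double+1 k) ⟨
  1ℙ ℙ.+ (ρ c ℙ.+ ρ (suc (2 * k)))          ≡⟨ cong (1ℙ ℙ.+_) ih ⟩
  1ℙ ℙ.+ parity J                           ≡⟨ parity-suc J ⟨
  parity (suc J)                            ∎
  where
  open ≡-Reasoning
  open import Algebra.Solver.CommutativeMonoid ℙ.+-0-commutativeMonoid using (solve; _⊕_; _⊜_)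
  c-parity : parity c ≡ 1ℙ ℙ.+ parity k
  c-parity = parity-complement {2 ^ J} k c eq′
  ih : ρ c ℙ.+ ρ (suc (2 * k)) ≡ parity J
  ih = ρ-complement J k c (*-cancelˡ-< 2 k (2 ^ J) k<2^J+1) eq′
  regroup : ∀ a b c d → (a ℙ.+ (b ℙ.+ c)) ℙ.+ d ≡ b ℙ.+ (a ℙ.+ (d ℙ.+ c))
  regroup = solve 4 (λ a b c d → (a ⊕ (b ⊕ c)) ⊕ d ⊜ b ⊕ (a ⊕ (d ⊕ c))) refl
... | odd+even k c eq′ = begin
  ρ (2 * c) ℙ.+ ρ (suc (2 * suc (2 * k))) ≡⟨ cong₂ ℙ._+_ (ρ-double c) (ρ-double+1-odd k) ⟩
  ρ c ℙ.+ (1ℙ ℙ.+ ρ (suc (2 * k)))        ≡⟨ x∙yz≈y∙xz (ρ c) 1ℙ (ρ (suc (2 * k))) ⟩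
  1ℙ ℙ.+ (ρ c ℙ.+ ρ (suc (2 * k)))        ≡⟨ cong (1ℙ ℙ.+_) ih ⟩
  1ℙ ℙ.+ parity J                         ≡⟨ parity-suc J ⟨
  parity (suc J)                          ∎
  where
  open ≡-Reasoning
  ih : ρ c ℙ.+ ρ (suc (2 * k)) ≡ parity J
  ih = ρ-complement J k c (*-cancelˡ-< 2 k (2 ^ J) (≤-trans (n≤1+n _) k<2^J+1)) eq′

n<2^n : ∀ n → n < 2 ^ n
n<2^n zero    = s≤s z≤n
n<2^n (suc n) = +-mono-≤ (≤-trans (s≤s z≤n) (n<2^n n)) (≤-trans (n<2^n n) (m≤m+n (2 ^ n) 0))

ρ-≡⇒r-≡ : ∀ m n → ρ m ≡ ρ n → r m ≡ r n
ρ-≡⇒r-≡ m n eq = trans (r≡toℕ∘ρ m) (trans (cong toℕ eq) (sym (r≡toℕ∘ρ n)))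

double-step : ∀ n d l → 2 * n + l * (2 * d) ≡ 2 * (n + l * d)
double-step = solve-∀

A-pt≤-double : ∀ n d L → A-pt≤ (2 * n) (2 * d) L ⇔ A-pt≤ n d L
A-pt≤-double n d L = mk⇔
  (λ (l , (1≤l , ne) , l≤L) → l , (1≤l , ne ∘ double-≡ l) , l≤L)
  (λ (l , (1≤l , ne) , l≤L) → l , (1≤l , ne ∘ halve-≡ l) , l≤L)
  where
  r-step : ∀ l → r (2 * n + l * (2 * d)) ≡ r (n + l * d)
  r-step l = trans (cong r (double-step n d l)) (r-double (n + l * d))
  double-≡ : ∀ l → r (n + l * d) ≡ r n → r (2 * n + l * (2 * d)) ≡ r (2 * n)
  double-≡ l eq = trans (r-step l) (trans eq (sym (r-double n)))
  halve-≡ : ∀ l → r (2 * n + l * (2 * d)) ≡ r (2 * n) → r (n + l * d) ≡ r n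
  halve-≡ l eq = trans (sym (r-step l)) (trans eq (r-double n))

change-double+1 : ∀ m d {l} → 1 ≤ l → ρ (suc (2 * (m + l * d))) ≢ ρ (suc (2 * m)) →
                  Change (suc (2 * m)) (2 * d) l
change-double+1 m d {l} 1≤l ne = 1≤l , ne ∘ r-≡⇒ρ-≡ (suc (2 * (m + l * d))) (suc (2 * m)) ∘ trans step
  where
  step : r (suc (2 * (m + l * d))) ≡ r (suc (2 * m + l * (2 * d)))
  step = cong (r ∘ suc) (sym (double-step m d l))

A≤⇒1≤ : ∀ {d L} → A≤ d L → 1 ≤ L
A≤⇒1≤ h with h 0
... | _ , (1≤l , _) , l≤L = ≤-trans 1≤l l≤L

A≤⇒ρ-odd-varies : ∀ {d L} → A≤ d L → ∀ m →
                  ∃ λ i → i ≤ L × ρ (suc (2 * (m + i * d))) ≢ ρ (suc (2 * (m + L * d)))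
A≤⇒ρ-odd-varies {d} {L} h m = mirror (h N)
  where
  X = m + L * d
  N = 2 ^ suc X ∸ suc X
  X-complement : suc (X + N) ≡ 2 ^ suc X
  X-complement = m+[n∸m]≡n (<⇒≤ (n<2^n (suc X)))
  regroup : ∀ m i l d N → m + i * d + (N + l * d) ≡ m + (i + l) * d + N
  regroup = solve-∀
  mirror : A-pt≤ N d L → ∃ λ i → i ≤ L × ρ (suc (2 * (m + i * d))) ≢ ρ (suc (2 * X))
  mirror (l , (_ , ne) , l≤L) = i , m∸n≤m L l , ne ∘ ρ-≡⇒r-≡ (N + l * d) N ∘ mirrored-≡
    where
    i = L ∸ l
    k = m + i * d
    k-complement : suc (k + (N + l * d)) ≡ 2 ^ suc X
    k-complement = trans (cong suc (trans (regroup m i l d N) (cong (λ j → m + j * d + N) (m∸n+n≡m l≤L))))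
                         X-complement
    k<2^X : k < 2 ^ X
    k<2^X = ≤-<-trans (+-monoʳ-≤ m (*-monoˡ-≤ d (m∸n≤m L l))) (n<2^n X)
    mirrored-≡ : ρ (suc (2 * k)) ≡ ρ (suc (2 * X)) → ρ (N + l * d) ≡ ρ N
    mirrored-≡ eq = ℙ.+-cancelʳ-≡ (ρ (suc (2 * X))) _ _ (begin
      ρ (N + l * d) ℙ.+ ρ (suc (2 * X)) ≡⟨ cong (ρ (N + l * d) ℙ.+_) eq ⟨
      ρ (N + l * d) ℙ.+ ρ (suc (2 * k)) ≡⟨ ρ-complement X k (N + l * d) k<2^X k-complement ⟩
      parity X                          ≡⟨ ρ-complement X X N (n<2^n X) X-complement ⟨
      ρ N ℙ.+ ρ (suc (2 * X))           ∎)
      where open ≡-Reasoning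

A-pt≤-double+1 : ∀ {d L} → A≤ d L → ∀ m → A-pt≤ (suc (2 * m)) (2 * d) L
A-pt≤-double+1 {d} {L} h m with A≤⇒ρ-odd-varies h m | ρ (suc (2 * (m + L * d))) ℙ.≟ ρ (suc (2 * m))
... | _                | no ne  = L , change-double+1 m d (A≤⇒1≤ h) ne , ≤-refl
... | zero  , _   , ne | yes eq = ⊥-elim (ne (trans (cong (λ j → ρ (suc (2 * j))) (+-identityʳ m)) (sym eq)))
... | suc i , i≤L , ne | yes eq = suc i , change-double+1 m d (s≤s z≤n) (ne ∘ flip trans (sym eq)) , i≤L

proposition6p10 : (d : ℕ) → 1 ≤ d → (L : ℕ) → (A≤ (2 * d) L ⇔ A≤ d L)
proposition6p10 d _ L = mk⇔ halve double
  where
  halve : A≤ (2 * d) L → A≤ d L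
  halve h n = Equivalence.to (A-pt≤-double n d L) (h (2 * n))
  double : A≤ d L → A≤ (2 * d) L
  double h n with halving n
  ... | even m = Equivalence.from (A-pt≤-double m d L) (h m)
  ... | odd m  = A-pt≤-double+1 h m
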